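{- For every integer $n\ge2$ we have $\dfrac{B_{n+1}}{B_n}\ge\dfrac{n}{2\log_e n}$.
   Context: $B_m$ denotes the $m$-th Bell number, the number of partitions of an $m$-element set. -}

module Defs where

open import Data.Nat as ℕ using (ℕ; zero; suc; _+_; _*_; _!; NonZero; z<s)
open import Data.Nat.Properties using (m≤m+n; ≤-trans; *-monoʳ-≤; ≤-refl)
open import Data.Integer using (+_)
open import Data.Rational as ℚ using (ℚ; 0ℚ; 1ℚ; _/_)
import Relation.Binary.PropositionalEquality as Eq

-- Bell numbers.
-- stirling2 n k = number of partitions of an n-element set into exactly
-- k nonempty blocks (Stirling numbers of the second kind), via the
-- standard recursion (the new element is either a singleton block or is
-- put into one of the k existing blocks).
-- bell m = Σ_{k=0}^{m} stirling2 m k = number of partitions of an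
-- m-element set.

stirling2 : ℕ → ℕ → ℕ
stirling2 zero    zero    = 1
stirling2 zero    (suc k) = 0
stirling2 (suc n) zero    = 0
stirling2 (suc n) (suc k) = suc k * stirling2 n (suc k) + stirling2 n k

sumUpTo : (ℕ → ℕ) → ℕ → ℕ
sumUpTo f zero    = f zero
sumUpTo f (suc K) = sumUpTo f K + f (suc K)

bell : ℕ → ℕ
bell m = sumUpTo (stirling2 m) m

private
  stirling-diag : ∀ n → 1 ℕ.≤ stirling2 n n
  stirling-diag zero    = ℕ.s≤s ℕ.z≤n
  stirling-diag (suc n) = ≤-trans (stirling-diag n)
                            (Data.Nat.Properties.m≤n+m (stirling2 n n) _)
    where import Data.Nat.Properties

  sum-last : ∀ f K → f K ℕ.≤ sumUpTo f K
  sum-last f zero    = ≤-refl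
  sum-last f (suc K) = Data.Nat.Properties.m≤n+m (f (suc K)) (sumUpTo f K)
    where import Data.Nat.Properties

bell-pos : ∀ m → 1 ℕ.≤ bell m
bell-pos m = ≤-trans (stirling-diag m) (sum-last (stirling2 m) m)

twoBellSuc-nonZero : ∀ n → NonZero (2 * bell (suc n))
twoBellSuc-nonZero n = ℕ.>-nonZero (≤-trans (bell-pos (suc n)) (m≤m+n _ _))

-- Natural logarithm, lower bounds only (no reals in agda-stdlib).
-- For a rational y ≥ 0 and n ≥ 1:   log_e n ≥ y  ⇔  e^y ≤ n
--   ⇔  every partial sum Σ_{k=0}^{K} y^k / k! of the exponential series
--      is ≤ n   (the partial sums increase to e^y since y ≥ 0).

powℚ : ℚ → ℕ → ℚ
powℚ y zero    = 1ℚ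
powℚ y (suc k) = y ℚ.* powℚ y k

expTerm : ℚ → ℕ → ℚ
expTerm y k = powℚ y k ℚ.* ((+ 1 / (k !)) {{Data.Nat.Properties._!≢0 k}})
  where import Data.Nat.Properties

expPartial : ℚ → ℕ → ℚ
expPartial y zero    = expTerm y zero
expPartial y (suc K) = expPartial y K ℚ.+ expTerm y (suc K)

-- LogAtLeast n y  :⇔  log_e n ≥ y    (intended for y ≥ 0)
LogAtLeast : ℕ → ℚ → Set
LogAtLeast n y = ∀ K → expPartial y K ℚ.≤ (+ n / 1)

bellRatio : ℕ → ℚ
bellRatio n = (+ (n * bell n) / (2 * bell (suc n))) {{twoBellSuc-nonZero n}}

-- Write b = B_n and c = B_{n+1}. The Bell numbers are log-convex: weighting
-- by S(n,k), B_n = Σ S(n,k), B_{n+1} = Σ (k+1) S(n,k) and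
-- B_{n+2} ≥ Σ (k+1)² S(n,k), so Cauchy–Schwarz applies. Hence
-- B_j ≥ b (b/c)^(n−j), and the recurrence B_{n+1} = Σ_j C(n,j) B_j gives
-- b (b + c)^n ≤ c^(n+1), that is (1 + b/c)^n ≤ c/b.
-- The claim is e^(nb/2c) ≤ n. If nb ≤ c the exponent is at most 1/2 and
-- e^(1/2) ≤ 2 ≤ n. Otherwise, as e^x ≤ (1 − x/n)^(−n),
-- e^(nb/2c) ≤ (1 − b/2c)^(−n) ≤ (1 + b/c)^n ≤ c/b ≤ n.
-- The exponential enters only through partial sums of its series; clearing
-- their denominators moves every estimate into ℕ.
module Submission where

open import Defs
open import Algebra.Bundles using (CommutativeMonoid)
import Algebra.Properties.CommutativeSemigroup as CommutativeSemigroupProperties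
open import Data.Nat using (ℕ; zero; suc; pred; _+_; _*_; _^_; _∸_; _!; _≤_; _>_; z≤n; s≤s; NonZero; >-nonZero)
open import Data.Nat.Properties
open import Data.Nat.Combinatorics using (_C_; nCk+nC[k+1]≡[n+1]C[k+1]; k>n⇒nCk≡0)
open import Data.Nat.Tactic.RingSolver using (solve-∀)
open import Data.Integer as ℤ using ()
import Data.Integer.Properties as ℤ
open import Data.Product using (_,_)
open import Data.Rational as ℚ using (ℚ; _/_)
import Data.Rational.Properties as ℚ
open import Data.Rational.Unnormalised as ℚᵘ using (ℚᵘ; mkℚᵘ; *≡*; *≤*)
import Data.Rational.Unnormalised.Properties as ℚᵘ
open import Data.Sum using (inj₁; inj₂)
open import Function using (_∘_; const)
open import Relation.Binary.PropositionalEquality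

module +-CS = CommutativeSemigroupProperties +-commutativeSemigroup
module *-CS = CommutativeSemigroupProperties *-commutativeSemigroup
module ℚ*-CS = CommutativeSemigroupProperties (CommutativeMonoid.commutativeSemigroup ℚ.*-1-commutativeMonoid)

sumUpTo-cong : ∀ {f g} K → (∀ k → k ≤ K → f k ≡ g k) → sumUpTo f K ≡ sumUpTo g K
sumUpTo-cong zero    f≗g = f≗g 0 z≤n
sumUpTo-cong (suc K) f≗g =
  cong₂ _+_ (sumUpTo-cong K λ k k≤K → f≗g k (m≤n⇒m≤1+n k≤K)) (f≗g (suc K) ≤-refl)

sumUpTo-mono-≤ : ∀ {f g} K → (∀ k → k ≤ K → f k ≤ g k) → sumUpTo f K ≤ sumUpTo g K
sumUpTo-mono-≤ zero    f≤g = f≤g 0 z≤n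
sumUpTo-mono-≤ (suc K) f≤g =
  +-mono-≤ (sumUpTo-mono-≤ K λ k k≤K → f≤g k (m≤n⇒m≤1+n k≤K)) (f≤g (suc K) ≤-refl)

sumUpTo-distrib-+ : ∀ f g K → sumUpTo (λ k → f k + g k) K ≡ sumUpTo f K + sumUpTo g K
sumUpTo-distrib-+ f g zero    = refl
sumUpTo-distrib-+ f g (suc K) = begin
  sumUpTo (λ k → f k + g k) K + (f (suc K) + g (suc K))   ≡⟨ cong (_+ (f (suc K) + g (suc K))) (sumUpTo-distrib-+ f g K) ⟩
  sumUpTo f K + sumUpTo g K + (f (suc K) + g (suc K))     ≡⟨ +-CS.interchange (sumUpTo f K) _ _ _ ⟩
  sumUpTo f K + f (suc K) + (sumUpTo g K + g (suc K))     ∎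
  where open ≡-Reasoning

*-distribˡ-sumUpTo : ∀ a f K → a * sumUpTo f K ≡ sumUpTo (λ k → a * f k) K
*-distribˡ-sumUpTo a f zero    = refl
*-distribˡ-sumUpTo a f (suc K) =
  trans (*-distribˡ-+ a (sumUpTo f K) (f (suc K))) (cong (_+ a * f (suc K)) (*-distribˡ-sumUpTo a f K))

sumUpTo-unfoldˡ : ∀ f K → sumUpTo f (suc K) ≡ f 0 + sumUpTo (f ∘ suc) K
sumUpTo-unfoldˡ f zero    = refl
sumUpTo-unfoldˡ f (suc K) = trans (cong (_+ f (suc (suc K))) (sumUpTo-unfoldˡ f K)) (+-assoc (f 0) _ _)

sumUpTo-dropLast : ∀ f K → f (suc K) ≡ 0 → sumUpTo f (suc K) ≡ sumUpTo f K
sumUpTo-dropLast f K f[1+K]≡0 = trans (cong (sumUpTo f K +_) f[1+K]≡0) (+-identityʳ _)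

m≤n⇒2mn≤m²+n² : ∀ {m n} → m ≤ n → 2 * m * n ≤ m * m + n * n
m≤n⇒2mn≤m²+n² {m} m≤n with d , refl ← m≤n⇒∃[o]m+o≡n m≤n =
  ≤-trans (m≤m+n _ (d * d)) (≤-reflexive (square m d))
  where
  square : ∀ m d → 2 * m * (m + d) + d * d ≡ m * m + (m + d) * (m + d)
  square = solve-∀

2mn≤m²+n² : ∀ m n → 2 * m * n ≤ m * m + n * n
2mn≤m²+n² m n with ≤-total m n
... | inj₁ m≤n = m≤n⇒2mn≤m²+n² m≤n
... | inj₂ n≤m = subst₂ _≤_ (swap n m) (+-comm (n * n) (m * m)) (m≤n⇒2mn≤m²+n² n≤m)
  where
  swap : ∀ x y → 2 * x * y ≡ 2 * y * x
  swap = solve-∀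

^-distribʳ-* : ∀ m n o → (m * n) ^ o ≡ m ^ o * n ^ o
^-distribʳ-* m n zero    = refl
^-distribʳ-* m n (suc o) = trans (cong (m * n *_) (^-distribʳ-* m n o)) (*-CS.interchange m n (m ^ o) (n ^ o))

m+n≡2o∧m≤o⇒o≤n : ∀ {m n o} → m + n ≡ 2 * o → m ≤ o → o ≤ n
m+n≡2o∧m≤o⇒o≤n {m} {n} {o} m+n≡2o m≤o = +-cancelˡ-≤ m o n (begin
  m + o         ≤⟨ +-monoˡ-≤ o m≤o ⟩
  o + o         ≡⟨ cong (o +_) (+-identityʳ o) ⟨
  2 * o         ≡⟨ m+n≡2o ⟨
  m + n         ∎)
  where open ≤-Reasoning

cauchySchwarz : ∀ (a w : ℕ → ℕ) K →
  sumUpTo (λ k → w k * a k) K * sumUpTo (λ k → w k * a k) K ≤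
  sumUpTo a K * sumUpTo (λ k → w k * w k * a k) K
cauchySchwarz a w zero    = ≤-reflexive (rearrange (w 0) (a 0))
  where
  rearrange : ∀ w a → w * a * (w * a) ≡ a * (w * w * a)
  rearrange = solve-∀
cauchySchwarz a w (suc K) = begin
  (X + x * α) * (X + x * α)                     ≡⟨ expand X x α ⟩
  X * X + α * (2 * x * X) + x * α * (x * α)     ≤⟨ +-monoˡ-≤ _ (+-mono-≤ (cauchySchwarz a w K) (*-monoʳ-≤ α cross)) ⟩
  A * Y + α * (x * x * A + Y) + x * α * (x * α) ≡⟨ collect A Y x α ⟩
  (A + α) * (Y + x * x * α)                     ∎
  where
  open ≤-Reasoning
  x = w (suc K)
  α = a (suc K)
  X = sumUpTo (λ k → w k * a k) K
  A = sumUpTo a K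
  Y = sumUpTo (λ k → w k * w k * a k) K
  expand : ∀ X x α → (X + x * α) * (X + x * α) ≡ X * X + α * (2 * x * X) + x * α * (x * α)
  expand = solve-∀
  collect : ∀ A Y x α → A * Y + α * (x * x * A + Y) + x * α * (x * α) ≡ (A + α) * (Y + x * x * α)
  collect = solve-∀
  termwise : ∀ x w a → 2 * x * (w * a) ≤ x * x * a + w * w * a
  termwise x w a = begin
    2 * x * (w * a)       ≡⟨ sym (*-assoc (2 * x) w a) ⟩
    2 * x * w * a         ≤⟨ *-monoˡ-≤ a (2mn≤m²+n² x w) ⟩
    (x * x + w * w) * a   ≡⟨ *-distribʳ-+ a (x * x) (w * w) ⟩
    x * x * a + w * w * a ∎
  cross : 2 * x * X ≤ x * x * A + Y
  cross = begin
    2 * x * X                                             ≡⟨ *-distribˡ-sumUpTo (2 * x) _ K ⟩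
    sumUpTo (λ k → 2 * x * (w k * a k)) K                 ≤⟨ sumUpTo-mono-≤ K (λ k _ → termwise x (w k) (a k)) ⟩
    sumUpTo (λ k → x * x * a k + w k * w k * a k) K       ≡⟨ sumUpTo-distrib-+ _ _ K ⟩
    sumUpTo (λ k → x * x * a k) K + Y                     ≡⟨ cong (_+ Y) (sym (*-distribˡ-sumUpTo (x * x) a K)) ⟩
    x * x * A + Y                                         ∎

-- Stirling and Bell numbers

k>n⇒stirling2≡0 : ∀ {n k} → k > n → stirling2 n k ≡ 0
k>n⇒stirling2≡0 {zero}  {suc k} _         = refl
k>n⇒stirling2≡0 {suc n} {suc k} (s≤s k>n)
  rewrite k>n⇒stirling2≡0 {n} {suc k} (m<n⇒m<1+n k>n) | k>n⇒stirling2≡0 k>n =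
  cong (_+ 0) (*-zeroʳ (suc k))

weightedBell : ℕ → (ℕ → ℕ) → ℕ
weightedBell n g = sumUpTo (λ k → g k * stirling2 n k) n

weightedBell-cong : ∀ n {g h} → (∀ k → g k ≡ h k) → weightedBell n g ≡ weightedBell n h
weightedBell-cong n g≗h = sumUpTo-cong n λ k _ → cong (_* stirling2 n k) (g≗h k)

weightedBell-mono-≤ : ∀ n {g h} → (∀ k → g k ≤ h k) → weightedBell n g ≤ weightedBell n h
weightedBell-mono-≤ n g≤h = sumUpTo-mono-≤ n λ k _ → *-monoˡ-≤ (stirling2 n k) (g≤h k)

weightedBell-distrib-+ : ∀ n f g → weightedBell n (λ k → f k + g k) ≡ weightedBell n f + weightedBell n g
weightedBell-distrib-+ n f g =
  trans (sumUpTo-cong n λ k _ → *-distribʳ-+ (stirling2 n k) (f k) (g k)) (sumUpTo-distrib-+ _ _ n)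

weightedBell-suc-cong : ∀ n g h → (∀ k → g (suc k) ≡ h (suc k)) → weightedBell (suc n) g ≡ weightedBell (suc n) h
weightedBell-suc-cong n g h g≗h = sumUpTo-cong (suc n) term
  where
  term : ∀ k → k ≤ suc n → g k * stirling2 (suc n) k ≡ h k * stirling2 (suc n) k
  term zero    _ = trans (*-zeroʳ (g 0)) (sym (*-zeroʳ (h 0)))
  term (suc k) _ = cong (_* stirling2 (suc n) (suc k)) (g≗h k)

weightedBell-suc : ∀ n g → weightedBell (suc n) g ≡ weightedBell n (λ k → k * g k + g (suc k))
weightedBell-suc n g = begin
  sumUpTo (λ k → g k * S (suc n) k) (suc n)
    ≡⟨ sumUpTo-unfoldˡ _ n ⟩
  g 0 * 0 + sumUpTo (λ k → g (suc k) * S (suc n) (suc k)) n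
    ≡⟨ cong₂ _+_ (*-zeroʳ (g 0)) (sumUpTo-cong n λ k _ → recurrence k) ⟩
  sumUpTo (λ k → f (suc k) + g (suc k) * S n k) n
    ≡⟨ sumUpTo-distrib-+ (f ∘ suc) _ n ⟩
  sumUpTo (f ∘ suc) n + sumUpTo (λ k → g (suc k) * S n k) n
    ≡⟨ cong (_+ sumUpTo (λ k → g (suc k) * S n k) n) shift ⟩
  sumUpTo f n + sumUpTo (λ k → g (suc k) * S n k) n
    ≡⟨ sumUpTo-distrib-+ f _ n ⟨
  sumUpTo (λ k → f k + g (suc k) * S n k) n
    ≡⟨ sumUpTo-cong n (λ k _ → *-distribʳ-+ (S n k) (k * g k) (g (suc k))) ⟨
  weightedBell n (λ k → k * g k + g (suc k))
    ∎
  where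
  open ≡-Reasoning
  S = stirling2
  f : ℕ → ℕ
  f k = k * g k * S n k
  recurrence : ∀ k → g (suc k) * S (suc n) (suc k) ≡ f (suc k) + g (suc k) * S n k
  recurrence k = trans (*-distribˡ-+ (g (suc k)) _ _)
                       (cong (_+ g (suc k) * S n k) (*-CS.x∙yz≈yx∙z (g (suc k)) (suc k) (S n (suc k))))
  shift : sumUpTo (f ∘ suc) n ≡ sumUpTo f n
  shift = trans (sym (sumUpTo-unfoldˡ f n))
                (sumUpTo-dropLast f n (trans (cong (f′ *_) (k>n⇒stirling2≡0 (n<1+n n))) (*-zeroʳ f′)))
    where f′ = suc n * g (suc n)

bell≡weightedBell : ∀ n → bell n ≡ weightedBell n (const 1)
bell≡weightedBell n = sumUpTo-cong n λ k _ → sym (*-identityˡ (stirling2 n k))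

bell-suc≡weightedBell : ∀ n → bell (suc n) ≡ weightedBell n suc
bell-suc≡weightedBell n = begin
  bell (suc n)                                ≡⟨ bell≡weightedBell (suc n) ⟩
  weightedBell (suc n) (const 1)              ≡⟨ weightedBell-suc n (const 1) ⟩
  weightedBell n (λ k → k * 1 + 1)            ≡⟨ weightedBell-cong n (λ k → trans (cong (_+ 1) (*-identityʳ k)) (+-comm k 1)) ⟩
  weightedBell n suc                          ∎
  where open ≡-Reasoning

bell-mono : ∀ n → bell n ≤ bell (suc n)
bell-mono n = begin
  bell n                         ≡⟨ bell≡weightedBell n ⟩
  weightedBell n (const 1)       ≤⟨ weightedBell-mono-≤ n (λ k → s≤s (z≤n {k})) ⟩
  weightedBell n suc             ≡⟨ bell-suc≡weightedBell n ⟨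
  bell (suc n)                   ∎
  where open ≤-Reasoning

bell-logConvex : ∀ n → bell (suc n) * bell (suc n) ≤ bell n * bell (suc (suc n))
bell-logConvex n = begin
  bell (suc n) * bell (suc n)
    ≡⟨ cong₂ _*_ (bell-suc≡weightedBell n) (bell-suc≡weightedBell n) ⟩
  weightedBell n suc * weightedBell n suc
    ≤⟨ cauchySchwarz (stirling2 n) suc n ⟩
  bell n * weightedBell n (λ k → suc k * suc k)
    ≤⟨ *-monoʳ-≤ (bell n) (weightedBell-mono-≤ n λ k → ≤-trans (m≤m+n _ 1) (≤-reflexive (square k))) ⟩
  bell n * weightedBell n (λ k → k * suc k + suc (suc k))
    ≡⟨ cong (bell n *_) (weightedBell-suc n suc) ⟨
  bell n * weightedBell (suc n) suc
    ≡⟨ cong (bell n *_) (bell-suc≡weightedBell (suc n)) ⟨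
  bell n * bell (suc (suc n))
    ∎
  where
  open ≤-Reasoning
  square : ∀ k → (1 + k) * (1 + k) + 1 ≡ k * (1 + k) + (2 + k)
  square = solve-∀

sumUpTo-pascal : ∀ n (X : ℕ → ℕ) →
  sumUpTo (λ j → (suc n C j) * X j) (suc n) ≡ sumUpTo (λ j → (n C j) * (X j + X (suc j))) n
sumUpTo-pascal n X = begin
  sumUpTo (λ j → (suc n C j) * X j) (suc n)                 ≡⟨ sumUpTo-unfoldˡ _ n ⟩
  1 * X 0 + sumUpTo (λ j → (suc n C suc j) * X (suc j)) n   ≡⟨ cong (1 * X 0 +_) split ⟩
  1 * X 0 + (P + Q)                                         ≡⟨ +-CS.x∙yz≈y∙xz (1 * X 0) P Q ⟩
  P + (1 * X 0 + Q)                                         ≡⟨ cong (P +_) unshift ⟩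
  P + R                                                     ≡⟨ +-comm P R ⟩
  R + P                                                     ≡⟨ sumUpTo-distrib-+ _ _ n ⟨
  sumUpTo (λ j → (n C j) * X j + (n C j) * X (suc j)) n     ≡⟨ sumUpTo-cong n (λ j _ → *-distribˡ-+ (n C j) (X j) (X (suc j))) ⟨
  sumUpTo (λ j → (n C j) * (X j + X (suc j))) n             ∎
  where
  open ≡-Reasoning
  P = sumUpTo (λ j → (n C j) * X (suc j)) n
  Q = sumUpTo (λ j → (n C suc j) * X (suc j)) n
  R = sumUpTo (λ j → (n C j) * X j) n
  pascal : ∀ j → (suc n C suc j) * X (suc j) ≡ (n C j) * X (suc j) + (n C suc j) * X (suc j)
  pascal j = trans (cong (_* X (suc j)) (sym (nCk+nC[k+1]≡[n+1]C[k+1] n j)))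
                   (*-distribʳ-+ (X (suc j)) (n C j) (n C suc j))
  split : sumUpTo (λ j → (suc n C suc j) * X (suc j)) n ≡ P + Q
  split = trans (sumUpTo-cong n λ j _ → pascal j) (sumUpTo-distrib-+ _ _ n)
  unshift : 1 * X 0 + Q ≡ R
  unshift = trans (sym (sumUpTo-unfoldˡ (λ j → (n C j) * X j) n))
                  (sumUpTo-dropLast _ n (cong (_* X (suc n)) (k>n⇒nCk≡0 (n<1+n n))))

binomialTheorem : ∀ n u v → sumUpTo (λ j → (n C j) * (u ^ (n ∸ j) * v ^ j)) n ≡ (u + v) ^ n
binomialTheorem zero    u v = refl
binomialTheorem (suc n) u v = begin
  sumUpTo (λ j → (suc n C j) * (u ^ (suc n ∸ j) * v ^ j)) (suc n)
    ≡⟨ sumUpTo-pascal n (λ j → u ^ (suc n ∸ j) * v ^ j) ⟩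
  sumUpTo (λ j → (n C j) * (u ^ (suc n ∸ j) * v ^ j + u ^ (n ∸ j) * (v * v ^ j))) n
    ≡⟨ sumUpTo-cong n term ⟩
  sumUpTo (λ j → (u + v) * ((n C j) * (u ^ (n ∸ j) * v ^ j))) n
    ≡⟨ *-distribˡ-sumUpTo (u + v) _ n ⟨
  (u + v) * sumUpTo (λ j → (n C j) * (u ^ (n ∸ j) * v ^ j)) n
    ≡⟨ cong ((u + v) *_) (binomialTheorem n u v) ⟩
  (u + v) * (u + v) ^ n
    ∎
  where
  open ≡-Reasoning
  factor : ∀ c u v U V → c * (u * U * V + U * (v * V)) ≡ (u + v) * (c * (U * V))
  factor = solve-∀
  term : ∀ j → j ≤ n → (n C j) * (u ^ (suc n ∸ j) * v ^ j + u ^ (n ∸ j) * (v * v ^ j))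
                      ≡ (u + v) * ((n C j) * (u ^ (n ∸ j) * v ^ j))
  term j j≤n rewrite +-∸-assoc 1 j≤n = factor (n C j) u v (u ^ (n ∸ j)) (v ^ j)

-- Weighted form of S(n+1, k+1) = Σ_j C(n,j) S(j,k).
binomial-weightedBell : ∀ n g → sumUpTo (λ j → (n C j) * weightedBell j g) n ≡ weightedBell (suc n) (g ∘ pred)
binomial-weightedBell zero    g = base (g 0)
  where
  base : ∀ x → 1 * (x * 1) ≡ x * 0 + x * (1 * 0 + 1)
  base = solve-∀
binomial-weightedBell (suc n) g = begin
  sumUpTo (λ j → (suc n C j) * weightedBell j g) (suc n)
    ≡⟨ sumUpTo-pascal n (λ j → weightedBell j g) ⟩
  sumUpTo (λ j → (n C j) * (weightedBell j g + weightedBell (suc j) g)) n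
    ≡⟨ sumUpTo-cong n (λ j _ → cong (λ w → (n C j) * (weightedBell j g + w)) (weightedBell-suc j g)) ⟩
  sumUpTo (λ j → (n C j) * (weightedBell j g + weightedBell j g′)) n
    ≡⟨ sumUpTo-cong n (λ j _ → *-distribˡ-+ (n C j) (weightedBell j g) _) ⟩
  sumUpTo (λ j → (n C j) * weightedBell j g + (n C j) * weightedBell j g′) n
    ≡⟨ sumUpTo-distrib-+ _ _ n ⟩
  sumUpTo (λ j → (n C j) * weightedBell j g) n + sumUpTo (λ j → (n C j) * weightedBell j g′) n
    ≡⟨ cong₂ _+_ (binomial-weightedBell n g) (binomial-weightedBell n g′) ⟩
  weightedBell (suc n) (g ∘ pred) + weightedBell (suc n) (g′ ∘ pred)
    ≡⟨ weightedBell-distrib-+ (suc n) (g ∘ pred) (g′ ∘ pred) ⟨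
  weightedBell (suc n) (λ k → g (pred k) + g′ (pred k))
    ≡⟨ weightedBell-suc-cong n (λ k → g (pred k) + g′ (pred k)) (λ k → k * g (pred k) + g k)
        (λ k → collect (g k) k (g (suc k))) ⟩
  weightedBell (suc n) (λ k → k * g (pred k) + g k)
    ≡⟨ weightedBell-suc (suc n) (g ∘ pred) ⟨
  weightedBell (suc (suc n)) (g ∘ pred)
    ∎
  where
  open ≡-Reasoning
  g′ : ℕ → ℕ
  g′ k = k * g k + g (suc k)
  collect : ∀ x k y → x + (k * x + y) ≡ (1 + k) * x + y
  collect = solve-∀

bell-recurrence : ∀ n → bell (suc n) ≡ sumUpTo (λ j → (n C j) * bell j) n
bell-recurrence n = begin
  bell (suc n)                                          ≡⟨ bell≡weightedBell (suc n) ⟩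
  weightedBell (suc n) (const 1)                        ≡⟨ binomial-weightedBell n (const 1) ⟨
  sumUpTo (λ j → (n C j) * weightedBell j (const 1)) n  ≡⟨ sumUpTo-cong n (λ j _ → cong ((n C j) *_) (bell≡weightedBell j)) ⟨
  sumUpTo (λ j → (n C j) * bell j) n                    ∎
  where open ≡-Reasoning

-- Log-convex sequences

module LogConvex (a : ℕ → ℕ) (a≢0 : ∀ n → NonZero (a n))
                 (logConvex : ∀ n → a (suc n) * a (suc n) ≤ a n * a (suc (suc n))) where

  ratio-increasing : ∀ j d → a (suc j) * a (d + j) ≤ a j * a (suc (d + j))
  ratio-increasing j zero    = ≤-reflexive (*-comm (a (suc j)) (a j))
  ratio-increasing j (suc d) = *-cancelˡ-≤ (a m) {{a≢0 m}} (begin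
    a m * (a (suc j) * a (suc m))     ≡⟨ *-CS.x∙yz≈yx∙z (a m) (a (suc j)) (a (suc m)) ⟩
    a (suc j) * a m * a (suc m)       ≤⟨ *-monoˡ-≤ (a (suc m)) (ratio-increasing j d) ⟩
    a j * a (suc m) * a (suc m)       ≡⟨ *-assoc (a j) (a (suc m)) (a (suc m)) ⟩
    a j * (a (suc m) * a (suc m))     ≤⟨ *-monoʳ-≤ (a j) (logConvex m) ⟩
    a j * (a m * a (suc (suc m)))     ≡⟨ *-CS.x∙yz≈y∙xz (a j) (a m) (a (suc (suc m))) ⟩
    a m * (a j * a (suc (suc m)))     ∎)
    where
    open ≤-Reasoning
    m = d + j

  power-bound : ∀ d j → a (d + j) ^ suc d ≤ a j * a (suc (d + j)) ^ d
  power-bound zero    j = ≤-refl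
  power-bound (suc d) j = begin
    a m * a m ^ suc d                   ≤⟨ *-monoʳ-≤ (a m) shifted ⟩
    a m * (a (suc j) * a (suc m) ^ d)   ≡⟨ *-CS.x∙yz≈yx∙z (a m) (a (suc j)) (a (suc m) ^ d) ⟩
    a (suc j) * a m * a (suc m) ^ d     ≤⟨ *-monoˡ-≤ (a (suc m) ^ d) (ratio-increasing j (suc d)) ⟩
    a j * a (suc m) * a (suc m) ^ d     ≡⟨ *-assoc (a j) (a (suc m)) (a (suc m) ^ d) ⟩
    a j * a (suc m) ^ suc d             ∎
    where
    open ≤-Reasoning
    m = suc d + j
    shifted : a m ^ suc d ≤ a (suc j) * a (suc m) ^ d
    shifted = subst (λ k → a k ^ suc d ≤ a (suc j) * a (suc k) ^ d) (+-suc d j) (power-bound d (suc j))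

  binomialTerm-bound : ∀ {j n} → j ≤ n → a n * (a n ^ (n ∸ j) * a (suc n) ^ j) ≤ a j * a (suc n) ^ n
  binomialTerm-bound {j} {n} j≤n with n ∸ j | m∸n+n≡m j≤n
  ... | d | refl = begin
    a m * (a m ^ d * a (suc m) ^ j)     ≡⟨ *-assoc (a m) (a m ^ d) (a (suc m) ^ j) ⟨
    a m ^ suc d * a (suc m) ^ j         ≤⟨ *-monoˡ-≤ (a (suc m) ^ j) (power-bound d j) ⟩
    a j * a (suc m) ^ d * a (suc m) ^ j ≡⟨ *-assoc (a j) (a (suc m) ^ d) (a (suc m) ^ j) ⟩
    a j * (a (suc m) ^ d * a (suc m) ^ j) ≡⟨ cong (a j *_) (^-distribˡ-+-* (a (suc m)) d j) ⟨
    a j * a (suc m) ^ m                 ∎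
    where
    open ≤-Reasoning
    m = d + j

bell≢0 : ∀ n → NonZero (bell n)
bell≢0 n = >-nonZero (bell-pos n)

bell-ratio-bound : ∀ n → bell n * (bell n + bell (suc n)) ^ n ≤ bell (suc n) ^ suc n
bell-ratio-bound n = begin
  b * (b + c) ^ n                                            ≡⟨ cong (b *_) (binomialTheorem n b c) ⟨
  b * sumUpTo (λ j → (n C j) * (b ^ (n ∸ j) * c ^ j)) n      ≡⟨ *-distribˡ-sumUpTo b _ n ⟩
  sumUpTo (λ j → b * ((n C j) * (b ^ (n ∸ j) * c ^ j))) n    ≤⟨ sumUpTo-mono-≤ n term ⟩
  sumUpTo (λ j → c ^ n * ((n C j) * bell j)) n               ≡⟨ *-distribˡ-sumUpTo (c ^ n) _ n ⟨
  c ^ n * sumUpTo (λ j → (n C j) * bell j) n                 ≡⟨ cong (c ^ n *_) (bell-recurrence n) ⟨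
  c ^ n * c                                                  ≡⟨ *-comm (c ^ n) c ⟩
  c * c ^ n                                                  ∎
  where
  open ≤-Reasoning
  open LogConvex bell bell≢0 bell-logConvex
  b = bell n
  c = bell (suc n)
  term : ∀ j → j ≤ n → b * ((n C j) * (b ^ (n ∸ j) * c ^ j)) ≤ c ^ n * ((n C j) * bell j)
  term j j≤n = begin
    b * ((n C j) * (b ^ (n ∸ j) * c ^ j))   ≡⟨ *-CS.x∙yz≈y∙xz b (n C j) _ ⟩
    (n C j) * (b * (b ^ (n ∸ j) * c ^ j))   ≤⟨ *-monoʳ-≤ (n C j) (binomialTerm-bound j≤n) ⟩
    (n C j) * (bell j * c ^ n)              ≡⟨ *-CS.x∙yz≈z∙xy (n C j) (bell j) (c ^ n) ⟩
    c ^ n * ((n C j) * bell j)              ∎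

-- Partial sums of the exponential series

-- scaledExpPartial p q K = K! q^K e_K(p/q), where e_K = expPartial is the
-- K-th partial sum of the exponential series.
scaledExpPartial : ℕ → ℕ → ℕ → ℕ
scaledExpPartial p q zero    = 1
scaledExpPartial p q (suc K) = suc K * q * scaledExpPartial p q K + p ^ suc K

scaledExpPartial-0 : ∀ q K → scaledExpPartial 0 q K ≡ q ^ K * K !
scaledExpPartial-0 q zero    = refl
scaledExpPartial-0 q (suc K) = begin
  suc K * q * scaledExpPartial 0 q K + 0 ^ suc K
    ≡⟨ cong₂ (λ x y → suc K * q * x + y) (scaledExpPartial-0 q K) (*-zeroˡ (0 ^ K)) ⟩
  suc K * q * (q ^ K * K !) + 0
    ≡⟨ regroup (suc K) q (q ^ K) (K !) ⟩
  q * q ^ K * (suc K * K !)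
    ∎
  where
  open ≡-Reasoning
  regroup : ∀ k q Q f → k * q * (Q * f) + 0 ≡ q * Q * (k * f)
  regroup = solve-∀

^-meanValue-≤ : ∀ p s k → (s + p) ^ suc k ≤ p ^ suc k + suc k * s * (s + p) ^ k
^-meanValue-≤ p s zero    = ≤-reflexive (linear s p)
  where
  linear : ∀ s p → (s + p) * 1 ≡ p * 1 + 1 * s * 1
  linear = solve-∀
^-meanValue-≤ p s (suc k) = begin
  A * A ^ suc k                                  ≤⟨ *-monoʳ-≤ A (^-meanValue-≤ p s k) ⟩
  A * (P + suc k * s * A ^ k)                    ≡⟨ expand s p P (A ^ k) (suc k) ⟩
  p * P + s * P + suc k * s * A ^ suc k          ≤⟨ +-monoˡ-≤ _ (+-monoʳ-≤ (p * P) (*-monoʳ-≤ s P≤A^[1+k])) ⟩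
  p * P + s * A ^ suc k + suc k * s * A ^ suc k  ≡⟨ collect (p * P) s (A ^ suc k) (suc k) ⟩
  p * P + suc (suc k) * s * A ^ suc k            ∎
  where
  open ≤-Reasoning
  A = s + p
  P = p ^ suc k
  P≤A^[1+k] : P ≤ A ^ suc k
  P≤A^[1+k] = ^-monoˡ-≤ (suc k) (m≤n+m p s)
  expand : ∀ s p P R k → (s + p) * (P + k * s * R) ≡ p * P + s * P + k * s * ((s + p) * R)
  expand = solve-∀
  collect : ∀ x s Q k → x + s * Q + k * s * Q ≡ x + (1 + k) * s * Q
  collect = solve-∀

-- Mean value bound, the derivative of e_{K+1} being e_K:
-- e_{K+1}(x + σ) ≤ e_{K+1}(x) + σ e_K(x + σ), with x = p/q and σ = s/q.
scaledExpPartial-increment : ∀ p s q K →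
  scaledExpPartial (s + p) q (suc K) ≤ scaledExpPartial p q (suc K) + s * suc K * scaledExpPartial (s + p) q K
scaledExpPartial-increment p s q zero    = ≤-reflexive (base q s p)
  where
  base : ∀ q s p → 1 * q * 1 + (s + p) * 1 ≡ 1 * q * 1 + p * 1 + s * 1 * 1
  base = solve-∀
scaledExpPartial-increment p s q (suc K) = begin
  k * q * E′ (suc K) + (s + p) ^ k
    ≤⟨ +-mono-≤ (*-monoʳ-≤ (k * q) (scaledExpPartial-increment p s q K)) (^-meanValue-≤ p s (suc K)) ⟩
  k * q * (E (suc K) + s * suc K * E′ K) + (p ^ k + k * s * (s + p) ^ suc K)
    ≡⟨ regroup k q (E (suc K)) s (E′ K) (p ^ k) (suc K) ((s + p) ^ suc K) ⟩
  (k * q * E (suc K) + p ^ k) + s * k * (suc K * q * E′ K + (s + p) ^ suc K)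
    ∎
  where
  open ≤-Reasoning
  k = suc (suc K)
  E = scaledExpPartial p q
  E′ = scaledExpPartial (s + p) q
  regroup : ∀ k q X s Y P k′ R →
    k * q * (X + s * k′ * Y) + (P + k * s * R) ≡ (k * q * X + P) + s * k * (k′ * q * Y + R)
  regroup = solve-∀

scaledExpPartial-+-≤ : ∀ p s q K →
  q * scaledExpPartial (s + p) q K ≤ q * scaledExpPartial p q K + s * scaledExpPartial (s + p) q K
scaledExpPartial-+-≤ p s q zero    = m≤m+n (q * 1) (s * 1)
scaledExpPartial-+-≤ p s q (suc K) = begin
  q * E′ (suc K)                           ≤⟨ *-monoʳ-≤ q (scaledExpPartial-increment p s q K) ⟩
  q * (E (suc K) + s * suc K * E′ K)       ≡⟨ regroup q (E (suc K)) s (suc K) (E′ K) ⟩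
  q * E (suc K) + s * (suc K * q * E′ K)   ≤⟨ +-monoʳ-≤ (q * E (suc K)) (*-monoʳ-≤ s (m≤m+n _ _)) ⟩
  q * E (suc K) + s * E′ (suc K)           ∎
  where
  open ≤-Reasoning
  E = scaledExpPartial p q
  E′ = scaledExpPartial (s + p) q
  regroup : ∀ q X s k Y → q * (X + s * k * Y) ≡ q * X + s * (k * q * Y)
  regroup = solve-∀

-- (1 − σ) e_K(x + σ) ≤ e_K(x), with x = p/q and σ = s/q.
scaledExpPartial-shift : ∀ {s t q} → s + t ≡ q → ∀ p K →
  t * scaledExpPartial (s + p) q K ≤ q * scaledExpPartial p q K
scaledExpPartial-shift {s} {t} {q} s+t≡q p K = +-cancelˡ-≤ (s * E′) (t * E′) (q * E) (begin
  s * E′ + t * E′   ≡⟨ *-distribʳ-+ E′ s t ⟨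
  (s + t) * E′      ≡⟨ cong (_* E′) s+t≡q ⟩
  q * E′            ≤⟨ scaledExpPartial-+-≤ p s q K ⟩
  q * E + s * E′    ≡⟨ +-comm (q * E) (s * E′) ⟩
  s * E′ + q * E    ∎)
  where
  open ≤-Reasoning
  E = scaledExpPartial p q K
  E′ = scaledExpPartial (s + p) q K

scaledExpPartial-iterate : ∀ {s t q} → s + t ≡ q → ∀ m K →
  t ^ m * scaledExpPartial (m * s) q K ≤ q ^ m * (q ^ K * K !)
scaledExpPartial-iterate s+t≡q zero    K = ≤-reflexive (cong (1 *_) (scaledExpPartial-0 _ K))
scaledExpPartial-iterate {s} {t} {q} s+t≡q (suc m) K = begin
  t * t ^ m * E (s + m * s)        ≡⟨ *-CS.xy∙z≈y∙xz t (t ^ m) (E (s + m * s)) ⟩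
  t ^ m * (t * E (s + m * s))      ≤⟨ *-monoʳ-≤ (t ^ m) (scaledExpPartial-shift {s} {t} s+t≡q (m * s) K) ⟩
  t ^ m * (q * E (m * s))          ≡⟨ *-CS.x∙yz≈y∙xz (t ^ m) q (E (m * s)) ⟩
  q * (t ^ m * E (m * s))          ≤⟨ *-monoʳ-≤ q (scaledExpPartial-iterate {s} {t} s+t≡q m K) ⟩
  q * (q ^ m * (q ^ K * K !))      ≡⟨ *-assoc q (q ^ m) _ ⟨
  q * q ^ m * (q ^ K * K !)        ∎
  where
  open ≤-Reasoning
  E = λ p → scaledExpPartial p q K

-- With t = 2c − b this says (1 − b/2c)^(−n) ≤ n.
pow-ratio-bound : ∀ {n b c t} .{{_ : NonZero c}} → b ≤ c → c ≤ n * b → b + t ≡ 2 * c →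
  b * (b + c) ^ n ≤ c ^ suc n → (2 * c) ^ n ≤ n * t ^ n
pow-ratio-bound {n} {b} {c} {t} b≤c c≤nb b+t≡2c ratio =
  *-cancelʳ-≤ (q ^ n) (n * t ^ n) (c ^ suc n) {{m^n≢0 c (suc n)}} (begin
    q ^ n * (c * c ^ n)               ≡⟨ *-CS.x∙yz≈y∙xz (q ^ n) c (c ^ n) ⟩
    c * (q ^ n * c ^ n)               ≡⟨ cong (c *_) (^-distribʳ-* q c n) ⟨
    c * (q * c) ^ n                   ≤⟨ *-mono-≤ c≤nb (^-monoˡ-≤ n qc≤t[b+c]) ⟩
    n * b * (t * (b + c)) ^ n         ≡⟨ cong (n * b *_) (^-distribʳ-* t (b + c) n) ⟩
    n * b * (t ^ n * (b + c) ^ n)     ≡⟨ rearrange n b (t ^ n) ((b + c) ^ n) ⟩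
    n * t ^ n * (b * (b + c) ^ n)     ≤⟨ *-monoʳ-≤ (n * t ^ n) ratio ⟩
    n * t ^ n * c ^ suc n             ∎)
  where
  open ≤-Reasoning
  q = 2 * c
  rearrange : ∀ n b T P → n * b * (T * P) ≡ n * T * (b * P)
  rearrange = solve-∀
  qc≤t[b+c] : q * c ≤ t * (b + c)
  qc≤t[b+c] = begin
    q * c             ≡⟨ cong (_* c) b+t≡2c ⟨
    (b + t) * c       ≡⟨ *-distribʳ-+ c b t ⟩
    b * c + t * c     ≤⟨ +-monoˡ-≤ (t * c) (*-monoʳ-≤ b (m+n≡2o∧m≤o⇒o≤n b+t≡2c b≤c)) ⟩
    b * t + t * c     ≡⟨ cong (_+ t * c) (*-comm b t) ⟩
    t * b + t * c     ≡⟨ *-distribˡ-+ t b c ⟨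
    t * (b + c)       ∎

ratio-bound⇒scaledExpPartial-bound : ∀ {n b c} K .{{_ : NonZero c}} → 2 ≤ n → b ≤ c →
  b * (b + c) ^ n ≤ c ^ suc n → scaledExpPartial (n * b) (2 * c) K ≤ n * ((2 * c) ^ K * K !)
ratio-bound⇒scaledExpPartial-bound {n} {b} {c} K 2≤n b≤c ratio with ≤-total (n * b) c
... | inj₁ nb≤c with t , nb+t≡2c ← m≤n⇒∃[o]m+o≡n (≤-trans nb≤c (m≤m+n c (c + 0))) =
  *-cancelˡ-≤ c (begin
    c * E (n * b)            ≤⟨ *-monoˡ-≤ (E (n * b)) (m+n≡2o∧m≤o⇒o≤n nb+t≡2c nb≤c) ⟩
    t * E (n * b)            ≡⟨ cong (λ x → t * E x) (+-identityʳ (n * b)) ⟨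
    t * E (n * b + 0)        ≤⟨ scaledExpPartial-shift {n * b} {t} nb+t≡2c 0 K ⟩
    2 * c * E 0              ≡⟨ cong (2 * c *_) (scaledExpPartial-0 (2 * c) K) ⟩
    2 * c * M                ≡⟨ *-CS.xy∙z≈y∙xz 2 c M ⟩
    c * (2 * M)              ≤⟨ *-monoʳ-≤ c (*-monoˡ-≤ M 2≤n) ⟩
    c * (n * M)              ∎)
  where
  open ≤-Reasoning
  E = λ p → scaledExpPartial p (2 * c) K
  M = (2 * c) ^ K * K !
... | inj₂ c≤nb with t , b+t≡2c ← m≤n⇒∃[o]m+o≡n (≤-trans b≤c (m≤m+n c (c + 0))) =
  *-cancelˡ-≤ (q ^ n) {{m^n≢0 q n {{m*n≢0 2 c}}}} (begin
    q ^ n * E (n * b)        ≤⟨ *-monoˡ-≤ (E (n * b)) (pow-ratio-bound {n} b≤c c≤nb b+t≡2c ratio) ⟩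
    n * t ^ n * E (n * b)    ≡⟨ *-assoc n (t ^ n) (E (n * b)) ⟩
    n * (t ^ n * E (n * b))  ≤⟨ *-monoʳ-≤ n (scaledExpPartial-iterate {b} {t} b+t≡2c n K) ⟩
    n * (q ^ n * M)          ≡⟨ *-CS.x∙yz≈y∙xz n (q ^ n) M ⟩
    q ^ n * (n * M)          ∎)
  where
  open ≤-Reasoning
  q = 2 * c
  E = λ p → scaledExpPartial p q K
  M = q ^ K * K !

-- Natural numbers as rationals

fromℕ : ℕ → ℚ
fromℕ n = ℤ.+ n / 1

fromℕᵘ : ℕ → ℚᵘ
fromℕᵘ n = mkℚᵘ (ℤ.+ n) 0

toℚᵘ-fromℕ : ∀ n → ℚ.toℚᵘ (fromℕ n) ℚᵘ.≃ fromℕᵘ n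
toℚᵘ-fromℕ n = ℚ.toℚᵘ-fromℚᵘ (fromℕᵘ n)

fromℕ-+ : ∀ m n → fromℕ (m + n) ≡ fromℕ m ℚ.+ fromℕ n
fromℕ-+ m n = ℚ.toℚᵘ-injective (begin
  ℚ.toℚᵘ (fromℕ (m + n))                     ≈⟨ toℚᵘ-fromℕ (m + n) ⟩
  fromℕᵘ (m + n)                             ≈⟨ *≡* numerators ⟩
  fromℕᵘ m ℚᵘ.+ fromℕᵘ n                     ≈⟨ ℚᵘ.+-cong (toℚᵘ-fromℕ m) (toℚᵘ-fromℕ n) ⟨
  ℚ.toℚᵘ (fromℕ m) ℚᵘ.+ ℚ.toℚᵘ (fromℕ n)     ≈⟨ ℚ.toℚᵘ-homo-+ (fromℕ m) (fromℕ n) ⟨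
  ℚ.toℚᵘ (fromℕ m ℚ.+ fromℕ n)               ∎)
  where
  open ℚᵘ.≃-Reasoning
  numerators : ℤ.+ (m + n) ℤ.* ℤ.+ 1 ≡ (ℤ.+ m ℤ.* ℤ.+ 1 ℤ.+ ℤ.+ n ℤ.* ℤ.+ 1) ℤ.* ℤ.+ 1
  numerators = trans (ℤ.*-identityʳ _) (trans (ℤ.pos-+ m n) (sym
    (trans (ℤ.*-identityʳ _) (cong₂ ℤ._+_ (ℤ.*-identityʳ (ℤ.+ m)) (ℤ.*-identityʳ (ℤ.+ n))))))

fromℕ-* : ∀ m n → fromℕ (m * n) ≡ fromℕ m ℚ.* fromℕ n
fromℕ-* m n = ℚ.toℚᵘ-injective (begin
  ℚ.toℚᵘ (fromℕ (m * n))                     ≈⟨ toℚᵘ-fromℕ (m * n) ⟩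
  fromℕᵘ (m * n)                             ≈⟨ *≡* (cong (ℤ._* ℤ.+ 1) (ℤ.pos-* m n)) ⟩
  fromℕᵘ m ℚᵘ.* fromℕᵘ n                     ≈⟨ ℚᵘ.*-cong (toℚᵘ-fromℕ m) (toℚᵘ-fromℕ n) ⟨
  ℚ.toℚᵘ (fromℕ m) ℚᵘ.* ℚ.toℚᵘ (fromℕ n)     ≈⟨ ℚ.toℚᵘ-homo-* (fromℕ m) (fromℕ n) ⟨
  ℚ.toℚᵘ (fromℕ m ℚ.* fromℕ n)               ∎)
  where open ℚᵘ.≃-Reasoning

fromℕ-mono-≤ : ∀ {m n} → m ≤ n → fromℕ m ℚ.≤ fromℕ n
fromℕ-mono-≤ {m} {n} m≤n = ℚ.toℚᵘ-cancel-≤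
  (ℚᵘ.≤-respˡ-≃ (ℚᵘ.≃-sym (toℚᵘ-fromℕ m)) (ℚᵘ.≤-respʳ-≃ (ℚᵘ.≃-sym (toℚᵘ-fromℕ n))
    (*≤* (ℤ.*-monoʳ-≤-nonNeg (ℤ.+ 1) (ℤ.+≤+ m≤n)))))

fromℕ-pos : ∀ n .{{_ : NonZero n}} → ℚ.Positive (fromℕ n)
fromℕ-pos n = ℚ.normalize-pos n 1

/-*-cancel : ∀ m n .{{_ : NonZero n}} → (ℤ.+ m / n) ℚ.* fromℕ n ≡ fromℕ m
/-*-cancel m n@(suc n-1) = ℚ.toℚᵘ-injective (begin
  ℚ.toℚᵘ ((ℤ.+ m / n) ℚ.* fromℕ n)
    ≈⟨ ℚ.toℚᵘ-homo-* (ℤ.+ m / n) (fromℕ n) ⟩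
  ℚ.toℚᵘ (ℤ.+ m / n) ℚᵘ.* ℚ.toℚᵘ (fromℕ n)
    ≈⟨ ℚᵘ.*-cong (ℚ.toℚᵘ-fromℚᵘ (mkℚᵘ (ℤ.+ m) n-1)) (toℚᵘ-fromℕ n) ⟩
  mkℚᵘ (ℤ.+ m) n-1 ℚᵘ.* fromℕᵘ n
    ≈⟨ *≡* numerators ⟩
  fromℕᵘ m
    ≈⟨ toℚᵘ-fromℕ m ⟨
  ℚ.toℚᵘ (fromℕ m)
    ∎)
  where
  open ℚᵘ.≃-Reasoning
  numerators : (ℤ.+ m ℤ.* ℤ.+ n) ℤ.* ℤ.+ 1 ≡ ℤ.+ m ℤ.* ℤ.+ (n * 1)
  numerators = trans (ℤ.*-identityʳ _) (cong (λ k → ℤ.+ m ℤ.* ℤ.+ k) (sym (*-identityʳ n)))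

module _ (p q : ℕ) .{{_ : NonZero q}} where

  private
    y : ℚ
    y = ℤ.+ p / q

  powℚ-scaled : ∀ k → powℚ y k ℚ.* fromℕ (q ^ k) ≡ fromℕ (p ^ k)
  powℚ-scaled zero    = refl
  powℚ-scaled (suc k) = begin
    (y ℚ.* powℚ y k) ℚ.* fromℕ (q * q ^ k)
      ≡⟨ cong ((y ℚ.* powℚ y k) ℚ.*_) (fromℕ-* q (q ^ k)) ⟩
    (y ℚ.* powℚ y k) ℚ.* (fromℕ q ℚ.* fromℕ (q ^ k))
      ≡⟨ ℚ*-CS.interchange y (powℚ y k) (fromℕ q) (fromℕ (q ^ k)) ⟩
    (y ℚ.* fromℕ q) ℚ.* (powℚ y k ℚ.* fromℕ (q ^ k))
      ≡⟨ cong₂ ℚ._*_ (/-*-cancel p q) (powℚ-scaled k) ⟩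
    fromℕ p ℚ.* fromℕ (p ^ k)
      ≡⟨ fromℕ-* p (p ^ k) ⟨
    fromℕ (p * p ^ k)
      ∎
    where open ≡-Reasoning

  expTerm-scaled : ∀ k → expTerm y k ℚ.* fromℕ (q ^ k * k !) ≡ fromℕ (p ^ k)
  expTerm-scaled k = begin
    (powℚ y k ℚ.* u) ℚ.* fromℕ (q ^ k * k !)
      ≡⟨ cong ((powℚ y k ℚ.* u) ℚ.*_) (fromℕ-* (q ^ k) (k !)) ⟩
    (powℚ y k ℚ.* u) ℚ.* (fromℕ (q ^ k) ℚ.* fromℕ (k !))
      ≡⟨ ℚ*-CS.interchange (powℚ y k) u (fromℕ (q ^ k)) (fromℕ (k !)) ⟩
    (powℚ y k ℚ.* fromℕ (q ^ k)) ℚ.* (u ℚ.* fromℕ (k !))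
      ≡⟨ cong₂ ℚ._*_ (powℚ-scaled k) (/-*-cancel 1 (k !) {{k !≢0}}) ⟩
    fromℕ (p ^ k) ℚ.* ℚ.1ℚ
      ≡⟨ ℚ.*-identityʳ (fromℕ (p ^ k)) ⟩
    fromℕ (p ^ k)
      ∎
    where
    open ≡-Reasoning
    u = (ℤ.+ 1 / k !) {{k !≢0}}

  expPartial-scaled : ∀ K → expPartial y K ℚ.* fromℕ (q ^ K * K !) ≡ fromℕ (scaledExpPartial p q K)
  expPartial-scaled zero    = expTerm-scaled zero
  expPartial-scaled (suc K) = begin
    (E K ℚ.+ expTerm y (suc K)) ℚ.* fromℕ F′
      ≡⟨ ℚ.*-distribʳ-+ (fromℕ F′) (E K) (expTerm y (suc K)) ⟩
    E K ℚ.* fromℕ F′ ℚ.+ expTerm y (suc K) ℚ.* fromℕ F′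
      ≡⟨ cong₂ ℚ._+_ previous (expTerm-scaled (suc K)) ⟩
    fromℕ (k * q * scaledExpPartial p q K) ℚ.+ fromℕ (p ^ suc K)
      ≡⟨ fromℕ-+ (k * q * scaledExpPartial p q K) (p ^ suc K) ⟨
    fromℕ (scaledExpPartial p q (suc K))
      ∎
    where
    open ≡-Reasoning
    E = expPartial y
    k = suc K
    F = q ^ K * K !
    F′ = q ^ k * k !
    regroup : ∀ q Q k f → q * Q * (k * f) ≡ k * q * (Q * f)
    regroup = solve-∀
    previous : E K ℚ.* fromℕ F′ ≡ fromℕ (k * q * scaledExpPartial p q K)
    previous = begin
      E K ℚ.* fromℕ F′                            ≡⟨ cong (λ x → E K ℚ.* fromℕ x) (regroup q (q ^ K) k (K !)) ⟩
      E K ℚ.* fromℕ (k * q * F)                   ≡⟨ cong (E K ℚ.*_) (fromℕ-* (k * q) F) ⟩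
      E K ℚ.* (fromℕ (k * q) ℚ.* fromℕ F)         ≡⟨ ℚ*-CS.x∙yz≈y∙xz (E K) (fromℕ (k * q)) (fromℕ F) ⟩
      fromℕ (k * q) ℚ.* (E K ℚ.* fromℕ F)         ≡⟨ cong (fromℕ (k * q) ℚ.*_) (expPartial-scaled K) ⟩
      fromℕ (k * q) ℚ.* fromℕ (scaledExpPartial p q K) ≡⟨ fromℕ-* (k * q) (scaledExpPartial p q K) ⟨
      fromℕ (k * q * scaledExpPartial p q K)      ∎

lemma2 : (n : ℕ) → 2 ≤ n → LogAtLeast n (bellRatio n)
lemma2 n 2≤n K = ℚ.*-cancelʳ-≤-pos (fromℕ M) {{fromℕ-pos M}} (begin
  expPartial (bellRatio n) K ℚ.* fromℕ M    ≡⟨ expPartial-scaled (n * b) q K ⟩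
  fromℕ (scaledExpPartial (n * b) q K)      ≤⟨ fromℕ-mono-≤ bound ⟩
  fromℕ (n * M)                             ≡⟨ fromℕ-* n M ⟩
  fromℕ n ℚ.* fromℕ M                       ∎)
  where
  open ℚ.≤-Reasoning
  b = bell n
  c = bell (suc n)
  q = 2 * c
  M = q ^ K * K !
  instance
    _ : NonZero c
    _ = bell≢0 (suc n)
    _ : NonZero q
    _ = twoBellSuc-nonZero n
    _ : NonZero M
    _ = m*n≢0 (q ^ K) (K !) {{m^n≢0 q K}} {{K !≢0}}
  bound : scaledExpPartial (n * b) q K ≤ n * M
  bound = ratio-bound⇒scaledExpPartial-bound K 2≤n (bell-mono n) (bell-ratio-bound n)
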